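{- Let $\mathcal{S}$, $\mathcal{MM}_2$ and the map $\phi:\mathcal{S}\to\mathcal{MM}_2$ be as described in the context. Then $\phi$ is one-to-one, and hence $\mathcal{S}$ is in bijection with the image $\phi(\mathcal{S})\subseteq\mathcal{MM}_2$.
   Context: A quarter plane walk is a finite walk in $\mathbb{Z}^2$ starting at $(0,0)$, staying in $\{(i,j): i\ge 0, j\ge 0\}$, using steps from a given set; its length is its number of steps. $\mathcal{S}$ is the class of quarter plane walks with steps from $\{(1,0),(1,-1),(0,-1),(-1,0),(-1,1),(0,1)\}$, written $\rightarrow,\searrow,\downarrow,\leftarrow,\nwarrow,\uparrow$ respectively. A Motzkin path is a walk from $(0,0)$ using the steps $\nearrow=(1,1)$, $\rightarrow=(1,0)$, $\searrow=(1,-1)$, never going below the $x$-axis and ending on the $x$-axis. $\mathcal{MM}_2$ is the class of Motzkin paths in which each step is coloured red or black and is additionally either marked or unmarked. The map $\phi$: given $w\in\mathcal{S}$, start with the empty path $m$ and read the steps of $w$ from first to last, modifying $m$ as follows. (1) Step $\uparrow$: append a marked red $\rightarrow$ to $m$. (2) Step $\rightarrow$: append a marked black $\rightarrow$ to $m$. (3) Step $\searrow$: find the rightmost step of $m$ that is either a marked red $\rightarrow$ or a marked black $\searrow$; if it is a marked red $\rightarrow$ replace it by an unmarked red $\nearrow$, if it is a marked black $\searrow$ replace it by an unmarked black $\rightarrow$. Then append a marked red $\searrow$. (4) Step $\nwarrow$: find the rightmost step of $m$ that is either a marked black $\rightarrow$ or a marked red $\searrow$; if it is a marked black $\rightarrow$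 replace it by an unmarked black $\nearrow$, if it is a marked red $\searrow$ replace it by an unmarked red $\rightarrow$. Then append a marked black $\searrow$. (5) Step $\leftarrow$: perform the same search and replacement as in (4), then append an unmarked red $\searrow$. (6) Step $\downarrow$: perform the same search and replacement as in (3), then append an unmarked black $\searrow$. The final $m$ is $\phi(w)$. (It is known that this procedure is always well defined and yields an element of $\mathcal{MM}_2$.) -}

module Defs where

open import Data.Nat using (ℕ; zero; suc)
open import Data.Bool using (Bool; true; false)
open import Data.Product using (_×_; _,_)
open import Data.List using (List; []; _∷_; reverse)
open import Data.Maybe using (Maybe; just; nothing)
open import Relation.Binary.PropositionalEquality using (_≡_)

data Step : Set where
  E SE S W NW N : Step

dec : ℕ → Maybe ℕ
dec zero    = nothing
dec (suc n) = just n

move : Step → ℕ × ℕ → Maybe (ℕ × ℕ)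
move E  (i , j) = just (suc i , j)
move SE (i , j) with dec j
... | just j' = just (suc i , j')
... | nothing = nothing
move S  (i , j) with dec j
... | just j' = just (i , j')
... | nothing = nothing
move W  (i , j) with dec i
... | just i' = just (i' , j)
... | nothing = nothing
move NW (i , j) with dec i
... | just i' = just (i' , suc j)
... | nothing = nothing
move N  (i , j) = just (i , suc j)

data Stays : ℕ × ℕ → List Step → Set where
  []  : ∀ {p} → Stays p []
  _∷_ : ∀ {p q s w} → move s p ≡ just q → Stays q w → Stays p (s ∷ w)

InS : List Step → Set
InS w = Stays (0 , 0) w

data Dir : Set where
  up flat down : Dir

data Colour : Set where
  red black : Colour

record MStep : Set where
  constructor mstep
  field
    dir    : Dir
    colour : Colour
    marked : Bool

-- The path m is kept in reversed order (last step first), so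
-- "rightmost" = "first" in the reversed list.  If the required step is not
-- found the procedure is undefined, and φ returns nothing.

replace3 : List MStep → Maybe (List MStep)
replace3 [] = nothing
replace3 (mstep flat red true ∷ m)    = just (mstep up red false ∷ m)
replace3 (mstep down black true ∷ m)  = just (mstep flat black false ∷ m)
replace3 (x ∷ m) with replace3 m
... | just m' = just (x ∷ m')
... | nothing = nothing

replace4 : List MStep → Maybe (List MStep)
replace4 [] = nothing
replace4 (mstep flat black true ∷ m)  = just (mstep up black false ∷ m)
replace4 (mstep down red true ∷ m)    = just (mstep flat red false ∷ m)
replace4 (x ∷ m) with replace4 m
... | just m' = just (x ∷ m')
... | nothing = nothing

φstep : Step → List MStep → Maybe (List MStep)
φstep N  m = just (mstep flat red true ∷ m)
φstep E  m = just (mstep flat black true ∷ m)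
φstep SE m with replace3 m
... | just m' = just (mstep down red true ∷ m')
... | nothing = nothing
φstep NW m with replace4 m
... | just m' = just (mstep down black true ∷ m')
... | nothing = nothing
φstep W  m with replace4 m
... | just m' = just (mstep down red false ∷ m')
... | nothing = nothing
φstep S  m with replace3 m
... | just m' = just (mstep down black false ∷ m')
... | nothing = nothing

φrev : List MStep → List Step → Maybe (List MStep)
φrev m []      = just m
φrev m (s ∷ w) with φstep s m
... | just m' = φrev m' w
... | nothing = nothing

φ : List Step → Maybe (List MStep)
φ w with φrev [] w
... | just m  = just (reverse m)
... | nothing = nothing

-- Each of the two searches
-- (rules 3, 6 and rules 4, 5) sees a step as a candidate it may replace, an opener (a replaced
-- candidate), a closer (a step appended by a rule that replaced something) or neutral. Read from
-- the right, the openers and closers of each search are well nested and every candidate lies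
-- outside all pairs, and each step of φ preserves this. So the step replaced by the last search
-- is the nearest unmatched opener; as the last step of φ(w) also tells which step of w produced
-- it, φ can be undone one step at a time. The numbers of candidates of the two searches are the
-- coordinates of the walk, so the quarter plane condition is what makes every search succeed.

module Submission where

open import Defs
open import Data.Bool using (true; false)
open import Data.Empty using (⊥)
open import Data.List using (List; []; _∷_; length; reverse)
open import Data.List.Properties using (reverse-injective)
open import Data.Maybe using (Maybe; just; nothing; map; _>>=_)
open import Data.Maybe.Properties using (just-injective)
open import Data.Nat using (ℕ; zero; suc; _+_)
open import Data.Nat.Properties using (suc-injective; +-identityʳ; +-suc)
open import Data.Product using (_×_; _,_; proj₁; ∃-syntax)
open import Data.Unit using (⊤; tt)
open import Relation.Binary.PropositionalEquality
  using (_≡_; refl; sym; trans; cong; cong₂; subst; module ≡-Reasoning)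
open ≡-Reasoning

data Role : Set where
  candidate opener closer neutral : Role

data NonCandidate : Role → Set where
  opener  : NonCandidate opener
  closer  : NonCandidate closer
  neutral : NonCandidate neutral

Continue : Role → ℕ → (ℕ → Set) → Set
Continue candidate k       P = k ≡ 0 × P 0
Continue opener    zero    P = ⊥
Continue opener    (suc k) P = P k
Continue closer    k       P = P (suc k)
Continue neutral   k       P = P k

-- Reading m from the right with k closers pending, every opener matches a pending closer and
-- candidates only occur while no closer is pending.
Matched : (MStep → Role) → ℕ → List MStep → Set
Matched role k []      = ⊤
Matched role k (x ∷ m) = Continue (role x) k (λ k′ → Matched role k′ m)

Continue-map : ∀ r k {P Q : ℕ → Set} → (∀ {k} → P k → Q k) → Continue r k P → Continue r k Q
Continue-map candidate k       f (k≡0 , p) = k≡0 , f p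
Continue-map opener    (suc k) f p         = f p
Continue-map closer    k       f p         = f p
Continue-map neutral   k       f p         = f p

Continue-suc : ∀ {r k} {P : ℕ → Set} → NonCandidate r →
               Continue r k (λ k′ → P (suc k′)) → Continue r (suc k) P
Continue-suc {k = suc k} opener p = p
Continue-suc closer  p = p
Continue-suc neutral p = p

weight : Role → ℕ
weight candidate = 1
weight _         = 0

#candidates : (MStep → Role) → List MStep → ℕ
#candidates role []      = 0
#candidates role (x ∷ m) = weight (role x) + #candidates role m

module Search (role other : MStep → Role) (toOpener fromOpener : MStep → MStep)
  (opening : ∀ {x} → role x ≡ candidate →
             role (toOpener x) ≡ opener × fromOpener (toOpener x) ≡ x
                                       × other (toOpener x) ≡ other x) where

  searchStep : Role → MStep → List MStep → Maybe (List MStep) → Maybe (List MStep)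
  searchStep candidate x m _     = just (toOpener x ∷ m)
  searchStep _         x _ found = map (x ∷_) found

  search : List MStep → Maybe (List MStep)
  search []      = nothing
  search (x ∷ m) = searchStep (role x) x m (search m)

  unsearchStep : Role → ℕ → MStep → List MStep → (ℕ → Maybe (List MStep)) → Maybe (List MStep)
  unsearchStep opener zero    x m _   = just (fromOpener x ∷ m)
  unsearchStep opener (suc k) x _ rec = map (x ∷_) (rec k)
  unsearchStep closer k       x _ rec = map (x ∷_) (rec (suc k))
  unsearchStep _      k       x _ rec = map (x ∷_) (rec k)

  unsearch : ℕ → List MStep → Maybe (List MStep)
  unsearch k []      = nothing
  unsearch k (x ∷ m) = unsearchStep (role x) k x m (λ k′ → unsearch k′ m)

  data SearchView (x : MStep) (m : List MStep) : List MStep → Set where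
    found-here  : role x ≡ candidate → SearchView x m (toOpener x ∷ m)
    found-later : ∀ {m₁} → NonCandidate (role x) → search m ≡ just m₁ → SearchView x m (x ∷ m₁)

  searchView : ∀ x m {m′} → search (x ∷ m) ≡ just m′ → SearchView x m m′
  searchView x m = view (role x) refl
    where
    later : ∀ {m′} → NonCandidate (role x) → map (x ∷_) (search m) ≡ just m′ → SearchView x m m′
    later nc e with search m in found
    later nc refl | just m₁ = found-later nc found

    view : ∀ r {m′} → role x ≡ r → searchStep r x m (search m) ≡ just m′ → SearchView x m m′
    view candidate rx refl = found-here rx
    view opener    rx e    = later (subst NonCandidate (sym rx) opener) e
    view closer    rx e    = later (subst NonCandidate (sym rx) closer) e
    view neutral   rx e    = later (subst NonCandidate (sym rx) neutral) e

  candidate-depth : ∀ {x k P} → role x ≡ candidate → Continue (role x) k P → k ≡ 0 × P 0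
  candidate-depth {k = k} {P} rx = subst (λ r → Continue r k P) rx

  unsearch-search : ∀ {k} m {m′} → Matched role k m → search m ≡ just m′ → unsearch k m′ ≡ just m
  unsearch-search {k} (x ∷ m) matched e with searchView x m e
  ... | found-here rx
    with refl , _ ← candidate-depth rx matched | opened , restored , _ ← opening rx
    rewrite opened | restored = refl
  ... | found-later nc found =
    unsearchStep-later nc (Continue-map (role x) k (λ mk → unsearch-search m mk found) matched)
    where
    unsearchStep-later : ∀ {r k m₁ f} → NonCandidate r → Continue r k (λ k′ → f k′ ≡ just m) →
                         unsearchStep r k x m₁ f ≡ just (x ∷ m)
    unsearchStep-later {k = suc k} opener eq rewrite eq = refl
    unsearchStep-later closer  eq rewrite eq = refl
    unsearchStep-later neutral eq rewrite eq = refl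

  Matched-search : ∀ {k} m {m′} → Matched role k m → search m ≡ just m′ → Matched role (suc k) m′
  Matched-search {k} (x ∷ m) matched e with searchView x m e
  ... | found-here rx with refl , matched-m ← candidate-depth rx matched | opened , _ ← opening rx
    rewrite opened = matched-m
  ... | found-later nc found =
    Continue-suc nc (Continue-map (role x) k (λ mk → Matched-search m mk found) matched)

  Matched-other-search : ∀ {k} m {m′} → search m ≡ just m′ → Matched other k m → Matched other k m′
  Matched-other-search {k} (x ∷ m) e matched with searchView x m e
  ... | found-here rx with _ , _ , other-kept ← opening rx rewrite other-kept = matched
  ... | found-later _ found = Continue-map (other x) k (Matched-other-search m found) matched

  length-search : ∀ m {m′} → search m ≡ just m′ → length m′ ≡ length m
  length-search (x ∷ m) e with searchView x m e
  ... | found-here _        = refl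
  ... | found-later _ found = cong suc (length-search m found)

  SearchResult : List MStep → ℕ → Maybe (List MStep) → Set
  SearchResult m n result = ∃[ m′ ] result ≡ just m′ × #candidates role m′ ≡ n
                                                   × #candidates other m′ ≡ #candidates other m

  search-skip : ∀ {x m n} → weight (role x) ≡ 0 →
                SearchResult m n (search m) → SearchResult (x ∷ m) n (map (x ∷_) (search m))
  search-skip {x} w (m₁ , found , c₁ , c₂) rewrite found =
    x ∷ m₁ , refl , trans (cong (_+ #candidates role m₁) w) c₁ , cong (weight (other x) +_) c₂

  search-succeeds : ∀ m {n} → #candidates role m ≡ suc n → SearchResult m n (search m)
  search-succeeds (x ∷ m) c with role x in rx
  ... | candidate with opened , _ , other-kept ← opening rx =
    toOpener x ∷ m , refl
    , trans (cong (λ r → weight r + #candidates role m) opened) (suc-injective c)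
    , cong (λ r → weight r + #candidates other m) other-kept
  ... | opener  = search-skip {x} {m} (cong weight rx) (search-succeeds m c)
  ... | closer  = search-skip {x} {m} (cong weight rx) (search-succeeds m c)
  ... | neutral = search-skip {x} {m} (cong weight rx) (search-succeeds m c)

-- A closer ↘ of one search that the other search replaces by → is still a closer, whence the
-- unmarked → closers.
role₃ : MStep → Role
role₃ (mstep flat red true)    = candidate
role₃ (mstep down black true)  = candidate
role₃ (mstep up red false)     = opener
role₃ (mstep flat black false) = opener
role₃ (mstep down red true)    = closer
role₃ (mstep down black false) = closer
role₃ (mstep flat red false)   = closer
role₃ _                        = neutral

role₄ : MStep → Role
role₄ (mstep flat black true)  = candidate
role₄ (mstep down red true)    = candidate
role₄ (mstep up black false)   = opener
role₄ (mstep flat red false)   = opener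
role₄ (mstep down black true)  = closer
role₄ (mstep down red false)   = closer
role₄ (mstep flat black false) = closer
role₄ _                        = neutral

toOpener₃ fromOpener₃ toOpener₄ fromOpener₄ : MStep → MStep
toOpener₃ (mstep flat red true)      = mstep up red false
toOpener₃ (mstep down black true)    = mstep flat black false
toOpener₃ x                          = x
fromOpener₃ (mstep up red false)     = mstep flat red true
fromOpener₃ (mstep flat black false) = mstep down black true
fromOpener₃ x                        = x
toOpener₄ (mstep flat black true)    = mstep up black false
toOpener₄ (mstep down red true)      = mstep flat red false
toOpener₄ x                          = x
fromOpener₄ (mstep up black false)   = mstep flat black true
fromOpener₄ (mstep flat red false)   = mstep down red true
fromOpener₄ x                        = x

opening₃ : ∀ {x} → role₃ x ≡ candidate →
           role₃ (toOpener₃ x) ≡ opener × fromOpener₃ (toOpener₃ x) ≡ x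
                                         × role₄ (toOpener₃ x) ≡ role₄ x
opening₃ {mstep flat red true}   refl = refl , refl , refl
opening₃ {mstep down black true} refl = refl , refl , refl
opening₃ {mstep up red true}      ()
opening₃ {mstep up red false}     ()
opening₃ {mstep flat black true}  ()
opening₃ {mstep flat black false} ()
opening₃ {mstep down red true}    ()
opening₃ {mstep down red false}   ()

opening₄ : ∀ {x} → role₄ x ≡ candidate →
           role₄ (toOpener₄ x) ≡ opener × fromOpener₄ (toOpener₄ x) ≡ x
                                         × role₃ (toOpener₄ x) ≡ role₃ x
opening₄ {mstep flat black true} refl = refl , refl , refl
opening₄ {mstep down red true}   refl = refl , refl , refl
opening₄ {mstep up black true}    ()
opening₄ {mstep up black false}   ()
opening₄ {mstep flat red true}    ()
opening₄ {mstep flat red false}   ()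
opening₄ {mstep down black true}  ()
opening₄ {mstep down black false} ()
module Search₃ = Search role₃ role₄ toOpener₃ fromOpener₃ opening₃
module Search₄ = Search role₄ role₃ toOpener₄ fromOpener₄ opening₄

replace3≡search₃ : ∀ m → replace3 m ≡ Search₃.search m
replace3≡search₃ [] = refl
replace3≡search₃ (mstep up red true ∷ m) rewrite replace3≡search₃ m with Search₃.search m
... | just _  = refl
... | nothing = refl
replace3≡search₃ (mstep up red false ∷ m) rewrite replace3≡search₃ m with Search₃.search m
... | just _  = refl
... | nothing = refl
replace3≡search₃ (mstep up black true ∷ m) rewrite replace3≡search₃ m with Search₃.search m
... | just _  = refl
... | nothing = refl
replace3≡search₃ (mstep up black false ∷ m) rewrite replace3≡search₃ m with Search₃.search m
... | just _  = refl
... | nothing = refl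
replace3≡search₃ (mstep flat red true ∷ m) = refl
replace3≡search₃ (mstep flat red false ∷ m) rewrite replace3≡search₃ m with Search₃.search m
... | just _  = refl
... | nothing = refl
replace3≡search₃ (mstep flat black true ∷ m) rewrite replace3≡search₃ m with Search₃.search m
... | just _  = refl
... | nothing = refl
replace3≡search₃ (mstep flat black false ∷ m) rewrite replace3≡search₃ m with Search₃.search m
... | just _  = refl
... | nothing = refl
replace3≡search₃ (mstep down red true ∷ m) rewrite replace3≡search₃ m with Search₃.search m
... | just _  = refl
... | nothing = refl
replace3≡search₃ (mstep down red false ∷ m) rewrite replace3≡search₃ m with Search₃.search m
... | just _  = refl
... | nothing = refl
replace3≡search₃ (mstep down black true ∷ m) = refl
replace3≡search₃ (mstep down black false ∷ m) rewrite replace3≡search₃ m with Search₃.search m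
... | just _  = refl
... | nothing = refl

replace4≡search₄ : ∀ m → replace4 m ≡ Search₄.search m
replace4≡search₄ [] = refl
replace4≡search₄ (mstep up red true ∷ m) rewrite replace4≡search₄ m with Search₄.search m
... | just _  = refl
... | nothing = refl
replace4≡search₄ (mstep up red false ∷ m) rewrite replace4≡search₄ m with Search₄.search m
... | just _  = refl
... | nothing = refl
replace4≡search₄ (mstep up black true ∷ m) rewrite replace4≡search₄ m with Search₄.search m
... | just _  = refl
... | nothing = refl
replace4≡search₄ (mstep up black false ∷ m) rewrite replace4≡search₄ m with Search₄.search m
... | just _  = refl
... | nothing = refl
replace4≡search₄ (mstep flat red true ∷ m) rewrite replace4≡search₄ m with Search₄.search m
... | just _  = refl
... | nothing = refl
replace4≡search₄ (mstep flat red false ∷ m) rewrite replace4≡search₄ m with Search₄.search m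
... | just _  = refl
... | nothing = refl
replace4≡search₄ (mstep flat black true ∷ m) = refl
replace4≡search₄ (mstep flat black false ∷ m) rewrite replace4≡search₄ m with Search₄.search m
... | just _  = refl
... | nothing = refl
replace4≡search₄ (mstep down red true ∷ m) = refl
replace4≡search₄ (mstep down red false ∷ m) rewrite replace4≡search₄ m with Search₄.search m
... | just _  = refl
... | nothing = refl
replace4≡search₄ (mstep down black true ∷ m) rewrite replace4≡search₄ m with Search₄.search m
... | just _  = refl
... | nothing = refl
replace4≡search₄ (mstep down black false ∷ m) rewrite replace4≡search₄ m with Search₄.search m
... | just _  = refl
... | nothing = refl
appendedBy : Step → MStep
appendedBy N  = mstep flat red true
appendedBy E  = mstep flat black true
appendedBy SE = mstep down red true
appendedBy NW = mstep down black true
appendedBy W  = mstep down red false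
appendedBy S  = mstep down black false

prepare : Step → List MStep → Maybe (List MStep)
prepare N  m = just m
prepare E  m = just m
prepare SE m = Search₃.search m
prepare S  m = Search₃.search m
prepare NW m = Search₄.search m
prepare W  m = Search₄.search m

φstep-prepare : ∀ s m → φstep s m ≡ map (appendedBy s ∷_) (prepare s m)
φstep-prepare N  m = refl
φstep-prepare E  m = refl
φstep-prepare SE m rewrite replace3≡search₃ m with Search₃.search m
... | just _  = refl
... | nothing = refl
φstep-prepare S  m rewrite replace3≡search₃ m with Search₃.search m
... | just _  = refl
... | nothing = refl
φstep-prepare NW m rewrite replace4≡search₄ m with Search₄.search m
... | just _  = refl
... | nothing = refl
φstep-prepare W  m rewrite replace4≡search₄ m with Search₄.search m
... | just _  = refl
... | nothing = refl

Balanced : List MStep → Set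
Balanced m = Matched role₃ 0 m × Matched role₄ 0 m

Balanced-prepare : ∀ s m {m₁} → Balanced m → prepare s m ≡ just m₁ → Balanced (appendedBy s ∷ m₁)
Balanced-prepare N  m (b₃ , b₄) refl = (refl , b₃) , b₄
Balanced-prepare E  m (b₃ , b₄) refl = b₃ , (refl , b₄)
Balanced-prepare SE m (b₃ , b₄) p =
  Search₃.Matched-search m b₃ p , (refl , Search₃.Matched-other-search m p b₄)
Balanced-prepare S  m (b₃ , b₄) p =
  Search₃.Matched-search m b₃ p , Search₃.Matched-other-search m p b₄
Balanced-prepare NW m (b₃ , b₄) p =
  (refl , Search₄.Matched-other-search m p b₃) , Search₄.Matched-search m b₄ p
Balanced-prepare W  m (b₃ , b₄) p =
  Search₄.Matched-other-search m p b₃ , Search₄.Matched-search m b₄ p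

unprepare : Step → List MStep → Maybe (List MStep)
unprepare N  m = just m
unprepare E  m = just m
unprepare SE m = Search₃.unsearch 0 m
unprepare S  m = Search₃.unsearch 0 m
unprepare NW m = Search₄.unsearch 0 m
unprepare W  m = Search₄.unsearch 0 m

unprepare-prepare : ∀ s m {m₁} → Balanced m → prepare s m ≡ just m₁ → unprepare s m₁ ≡ just m
unprepare-prepare N  m _         refl = refl
unprepare-prepare E  m _         refl = refl
unprepare-prepare SE m (b₃ , _)  p    = Search₃.unsearch-search m b₃ p
unprepare-prepare S  m (b₃ , _)  p    = Search₃.unsearch-search m b₃ p
unprepare-prepare NW m (_  , b₄) p    = Search₄.unsearch-search m b₄ p
unprepare-prepare W  m (_  , b₄) p    = Search₄.unsearch-search m b₄ p

length-prepare : ∀ s m {m₁} → prepare s m ≡ just m₁ → length m₁ ≡ length m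
length-prepare N  m refl = refl
length-prepare E  m refl = refl
length-prepare SE m p    = Search₃.length-search m p
length-prepare S  m p    = Search₃.length-search m p
length-prepare NW m p    = Search₄.length-search m p
length-prepare W  m p    = Search₄.length-search m p

position : List MStep → ℕ × ℕ
position m = #candidates role₄ m , #candidates role₃ m

prepare-move : ∀ s m {q} → move s (position m) ≡ just q →
               ∃[ m₁ ] prepare s m ≡ just m₁ × position (appendedBy s ∷ m₁) ≡ q
prepare-move N m refl = m , refl , refl
prepare-move E m refl = m , refl , refl
prepare-move SE m e with #candidates role₃ m in c₃
prepare-move SE m refl | suc _ with m₁ , p , d₃ , d₄ ← Search₃.search-succeeds m c₃ =
  m₁ , p , cong₂ _,_ (cong suc d₄) d₃
prepare-move S m e with #candidates role₃ m in c₃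
prepare-move S m refl | suc _ with m₁ , p , d₃ , d₄ ← Search₃.search-succeeds m c₃ =
  m₁ , p , cong₂ _,_ d₄ d₃
prepare-move NW m e with #candidates role₄ m in c₄
prepare-move NW m refl | suc _ with m₁ , p , d₄ , d₃ ← Search₄.search-succeeds m c₄ =
  m₁ , p , cong₂ _,_ d₄ (cong suc d₃)
prepare-move W m e with #candidates role₄ m in c₄
prepare-move W m refl | suc _ with m₁ , p , d₄ , d₃ ← Search₄.search-succeeds m c₄ =
  m₁ , p , cong₂ _,_ d₄ d₃

data Run : List MStep → List Step → List MStep → Set where
  done : ∀ {m} → Run m [] m
  step : ∀ {m m₁ r s w} → prepare s m ≡ just m₁ → Run (appendedBy s ∷ m₁) w r → Run m (s ∷ w) r

Run-total : ∀ m w → Stays (position m) w → ∃[ r ] Run m w r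
Run-total m []      []         = m , done
Run-total m (s ∷ w) (mv ∷ st) with m₁ , p , refl ← prepare-move s m mv
  with r , run ← Run-total (appendedBy s ∷ m₁) w st = r , step p run

Run⇒φrev : ∀ {m w r} → Run m w r → φrev m w ≡ just r
Run⇒φrev done = refl
Run⇒φrev (step {m} {s = s} p run) rewrite φstep-prepare s m | p = Run⇒φrev run

φ-Run : ∀ {w r} → Run [] w r → φ w ≡ just (reverse r)
φ-Run run rewrite Run⇒φrev run = refl

Run-length : ∀ {m w r} → Run m w r → length r ≡ length w + length m
Run-length done = refl
Run-length (step {m} {m₁} {r} {s} {w} p run) = begin
  length r                          ≡⟨ Run-length run ⟩
  length w + suc (length m₁)        ≡⟨ +-suc (length w) (length m₁) ⟩
  suc (length w + length m₁)        ≡⟨ cong (λ n → suc (length w + n)) (length-prepare s m p) ⟩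
  suc (length w + length m)         ∎

lastStep : MStep → Maybe Step
lastStep (mstep flat red true)    = just N
lastStep (mstep flat black true)  = just E
lastStep (mstep down red true)    = just SE
lastStep (mstep down black true)  = just NW
lastStep (mstep down red false)   = just W
lastStep (mstep down black false) = just S
lastStep _                        = nothing

lastStep-appendedBy : ∀ s → lastStep (appendedBy s) ≡ just s
lastStep-appendedBy N  = refl
lastStep-appendedBy E  = refl
lastStep-appendedBy SE = refl
lastStep-appendedBy NW = refl
lastStep-appendedBy W  = refl
lastStep-appendedBy S  = refl

rewindStep : List Step × List MStep → Maybe (List Step × List MStep)
rewindStep (w , [])    = nothing
rewindStep (w , x ∷ m) = lastStep x >>= λ s → map (λ m₀ → s ∷ w , m₀) (unprepare s m)

rewind : ℕ → List MStep → Maybe (List Step × List MStep)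
rewind zero    r = just ([] , r)
rewind (suc n) r = rewind n r >>= rewindStep

Run-rewind : ∀ {m w r} → Balanced m → Run m w r → rewind (length w) r ≡ just (w , m)
Run-rewind b done = refl
Run-rewind {m} b (step {s = s} p run)
  rewrite Run-rewind (Balanced-prepare s m b p) run
        | lastStep-appendedBy s
        | unprepare-prepare s m b p = refl

decode : List MStep → Maybe (List Step × List MStep)
decode r = rewind (length r) r

decode-Run : ∀ {w r} → Run [] w r → decode r ≡ just (w , [])
decode-Run {w} run rewrite Run-length run | +-identityʳ (length w) = Run-rewind (tt , tt) run

Run-injective : ∀ {w₁ w₂ r} → Run [] w₁ r → Run [] w₂ r → w₁ ≡ w₂
Run-injective run₁ run₂ =
  cong proj₁ (just-injective (trans (sym (decode-Run run₁)) (decode-Run run₂)))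

mainTheorem4 : (w₁ w₂ : List Step) → InS w₁ → InS w₂ → φ w₁ ≡ φ w₂ → w₁ ≡ w₂
mainTheorem4 w₁ w₂ s₁ s₂ φw₁≡φw₂
  with r₁ , run₁ ← Run-total [] w₁ s₁ | r₂ , run₂ ← Run-total [] w₂ s₂
  with refl ← reverse-injective {x = r₁} {y = r₂} (just-injective (begin
    just (reverse r₁)  ≡⟨ φ-Run run₁ ⟨
    φ w₁               ≡⟨ φw₁≡φw₂ ⟩
    φ w₂               ≡⟨ φ-Run run₂ ⟩
    just (reverse r₂)  ∎))
  = Run-injective run₁ run₂
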